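{- Let $M$ be an internally $4$-connected matroid having at least ten elements. If $(\{1,2,3\},\{4,5,6\},\{2,3,4,5\})$ is a bowtie in $M$, then $\{2,3,4,5\}$ is the unique $4$-cocircuit of $M$ that meets both $\{1,2,3\}$ and $\{4,5,6\}$.
   Context: A triangle is a $3$-element circuit and a triad a $3$-element cocircuit. A matroid is internally $4$-connected if it is $3$-connected and for every $3$-separation $(X,Y)$ one of $X,Y$ is a triangle or a triad. A bowtie $(T_1,T_2,D^*)$ in $M$ consists of two disjoint triangles $T_1,T_2$ and a $4$-element cocircuit $D^*\subseteq T_1\cup T_2$. -}

module Defs where

open import Data.Nat using (ℕ; suc; _+_; _∸_; _≤_; _<_)
open import Data.Fin using (Fin)
open import Data.Fin.Subset using (Subset; ⊥; ⊤; ⁅_⁆; _∈_; _⊆_; _∩_; _∪_; ∁; _-_; ∣_∣; Nonempty)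
open import Data.Product using (_×_; Σ)
open import Data.Sum using (_⊎_)
open import Relation.Binary.PropositionalEquality using (_≡_)

record Matroid (n : ℕ) : Set where
  field
    r         : Subset n → ℕ
    r-bound   : ∀ X → r X ≤ ∣ X ∣
    r-mono    : ∀ X Y → X ⊆ Y → r X ≤ r Y
    r-submod  : ∀ X Y → r (X ∪ Y) + r (X ∩ Y) ≤ r X + r Y

module _ {n : ℕ} (M : Matroid n) where
  open Matroid M

  rM : ℕ
  rM = r ⊤

  IsCircuit : Subset n → Set
  IsCircuit C = (r C < ∣ C ∣) × (∀ e → e ∈ C → r (C - e) ≡ ∣ C - e ∣)

  -- a cocircuit: a minimal set meeting every basis, i.e. a minimal set
  -- whose complement is non-spanning
  IsCocircuit : Subset n → Set
  IsCocircuit C = (r (∁ C) < rM) × (∀ e → e ∈ C → r (∁ (C - e)) ≡ rM)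

  IsTriangle : Subset n → Set
  IsTriangle T = IsCircuit T × ∣ T ∣ ≡ 3

  IsTriad : Subset n → Set
  IsTriad T = IsCocircuit T × ∣ T ∣ ≡ 3

  Is4Cocircuit : Subset n → Set
  Is4Cocircuit C = IsCocircuit C × ∣ C ∣ ≡ 4

  IsSeparation : ℕ → Subset n → Set
  IsSeparation k X = (k ≤ ∣ X ∣) × (k ≤ ∣ ∁ X ∣) × (r X + r (∁ X) < rM + k)

  ThreeConnected : Set
  ThreeConnected = ∀ k X → k < 3 → IsSeparation k X → Data.Empty.⊥
    where import Data.Empty

  InternallyFourConnected : Set
  InternallyFourConnected =
    ThreeConnected ×
    (∀ X → IsSeparation 3 X →
       (IsTriangle X ⊎ IsTriad X) ⊎ (IsTriangle (∁ X) ⊎ IsTriad (∁ X)))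

  IsBowtie : Subset n → Subset n → Subset n → Set
  IsBowtie T₁ T₂ D =
    IsTriangle T₁ × IsTriangle T₂ × (T₁ ∩ T₂ ≡ ⊥) ×
    Is4Cocircuit D × D ⊆ (T₁ ∪ T₂)

⁅_,_,_⁆ : ∀ {n} → Fin n → Fin n → Fin n → Subset n
⁅ a , b , c ⁆ = ⁅ a ⁆ ∪ (⁅ b ⁆ ∪ ⁅ c ⁆)

⁅_,_,_,_⁆ : ∀ {n} → Fin n → Fin n → Fin n → Fin n → Subset n
⁅ a , b , c , d ⁆ = ⁅ a ⁆ ∪ (⁅ b ⁆ ∪ (⁅ c ⁆ ∪ ⁅ d ⁆))

Meets : ∀ {n} → Subset n → Subset n → Set
Meets X Y = Nonempty (X ∩ Y)

-- By orthogonality the 4-cocircuit C meets each of the disjoint triangles T₁, T₂ in at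
-- least two elements, so C lies in X = T₁ ∪ T₂, as D = {2,3,4,5} does. Two distinct
-- cocircuits inside X force r(E − X) ≤ r(M) − 2, and since r(X) ≤ 4 this makes
-- (X, E − X) a 3-separation. With |X| = 6 and |E − X| ≥ 4 neither side is a triangle
-- or a triad, contradicting internal 4-connectivity; hence C = D.
module Submission where

open import Defs
open import Data.Nat using (ℕ; suc; _≤_; _<_; _+_; _∸_; z≤n; s≤s)
open import Data.Nat.Properties hiding (_≟_)
open import Data.Fin using (Fin; _≟_)
open import Data.Fin.Properties using (any?)
open import Data.Fin.Subset renaming (⊥ to ∅)
open import Data.Fin.Subset.Properties
open import Data.List using (List; []; _∷_; length)
open import Data.List.Relation.Unary.All using (All; []; _∷_)
open import Data.List.Relation.Unary.AllPairs using ([]; _∷_)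
open import Data.List.Relation.Unary.Unique.Propositional using (Unique)
open import Data.Vec using (_∷_; []; here; there)
open import Data.Product using (∃; _×_; proj₁; proj₂)
import Data.Product as Product
open import Data.Sum using (_⊎_; inj₁; inj₂)
open import Data.Empty using (⊥; ⊥-elim)
open import Relation.Nullary using (¬_; yes; no; ¬?)
open import Relation.Nullary.Decidable using (_×-dec_; decidable-stable)
open import Relation.Binary.PropositionalEquality
open import Function using (_∘_)

-- Pairs are opened only in here: at top level `_,_` would make the set notation
-- ⁅ e₁ , e₂ , e₃ ⁆ of the theorem ambiguous.
module _ where
  open Product using (_,_)

  private variable
    n : ℕ
    p q : Subset n
    x : Fin n

  ∣p∪q∣+∣p∩q∣≡∣p∣+∣q∣ : ∀ (p q : Subset n) → ∣ p ∪ q ∣ + ∣ p ∩ q ∣ ≡ ∣ p ∣ + ∣ q ∣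
  ∣p∪q∣+∣p∩q∣≡∣p∣+∣q∣ []            []            = refl
  ∣p∪q∣+∣p∩q∣≡∣p∣+∣q∣ (outside ∷ p) (outside ∷ q) = ∣p∪q∣+∣p∩q∣≡∣p∣+∣q∣ p q
  ∣p∪q∣+∣p∩q∣≡∣p∣+∣q∣ (outside ∷ p) (inside  ∷ q) =
    trans (cong suc (∣p∪q∣+∣p∩q∣≡∣p∣+∣q∣ p q)) (sym (+-suc _ _))
  ∣p∪q∣+∣p∩q∣≡∣p∣+∣q∣ (inside  ∷ p) (outside ∷ q) = cong suc (∣p∪q∣+∣p∩q∣≡∣p∣+∣q∣ p q)
  ∣p∪q∣+∣p∩q∣≡∣p∣+∣q∣ (inside  ∷ p) (inside  ∷ q) =
    cong suc (trans (+-suc _ _) (trans (cong suc (∣p∪q∣+∣p∩q∣≡∣p∣+∣q∣ p q)) (sym (+-suc _ _))))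

  ∣p∪q∣≡∣p∣+∣q∣ : ∀ (p q : Subset n) → p ∩ q ≡ ∅ → ∣ p ∪ q ∣ ≡ ∣ p ∣ + ∣ q ∣
  ∣p∪q∣≡∣p∣+∣q∣ {n} p q p∩q≡∅ = begin
    ∣ p ∪ q ∣                ≡⟨ +-identityʳ _ ⟨
    ∣ p ∪ q ∣ + 0            ≡⟨ cong (∣ p ∪ q ∣ +_) (∣⊥∣≡0 n) ⟨
    ∣ p ∪ q ∣ + ∣ ∅ {n} ∣    ≡⟨ cong (λ s → ∣ p ∪ q ∣ + ∣ s ∣) p∩q≡∅ ⟨
    ∣ p ∪ q ∣ + ∣ p ∩ q ∣    ≡⟨ ∣p∪q∣+∣p∩q∣≡∣p∣+∣q∣ p q ⟩
    ∣ p ∣ + ∣ q ∣            ∎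
    where open ≡-Reasoning

  x∈p⇒∣p∣≡1+∣p-x∣ : x ∈ p → ∣ p ∣ ≡ suc ∣ p - x ∣
  x∈p⇒∣p∣≡1+∣p-x∣ {p = inside  ∷ p} here          = cong (suc ∘ ∣_∣) (sym (p─⊥≡p p))
  x∈p⇒∣p∣≡1+∣p-x∣ {p = outside ∷ p} (there x∈p) = x∈p⇒∣p∣≡1+∣p-x∣ x∈p
  x∈p⇒∣p∣≡1+∣p-x∣ {p = inside  ∷ p} (there x∈p) = cong suc (x∈p⇒∣p∣≡1+∣p-x∣ x∈p)

  x∉p-x : x ∉ p - x
  x∉p-x {x = Fin.zero}  {_ ∷ p} ()
  x∉p-x {x = Fin.suc x} {_ ∷ p} (there x∈p-x) = x∉p-x {x = x} {p} x∈p-x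

  ∁[p-x]⊆∁p∪q : x ∈ q → ∁ (p - x) ⊆ ∁ p ∪ q
  ∁[p-x]⊆∁p∪q {x = x} x∈q {y} y∈∁[p-x] with y ≟ x
  ... | yes refl = x∈p∪q⁺ (inj₂ x∈q)
  ... | no  y≢x  = x∈p∪q⁺ (inj₁ (x∉p⇒x∈∁p λ y∈p →
                     x∈∁p⇒x∉p y∈∁[p-x] (x∈p∧x≢y⇒x∈p-y y∈p y≢x)))

  p⊈q⇒∃∈p∉q : ¬ p ⊆ q → ∃ λ x → x ∈ p × x ∉ q
  p⊈q⇒∃∈p∉q {p = p} {q} p⊈q with any? (λ x → x ∈? p ×-dec ¬? (x ∈? q))
  ... | yes witness = witness
  ... | no  none    = ⊥-elim (p⊈q λ {x} x∈p →
                        decidable-stable (x ∈? q) λ x∉q → none (x , x∈p , x∉q))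

  length≤∣p∣ : {xs : List (Fin n)} → Unique xs → All (_∈ p) xs → length xs ≤ ∣ p ∣
  length≤∣p∣ []                       []            = z≤n
  length≤∣p∣ (x≢xs ∷ xs-unique) (x∈p ∷ xs∈p) =
    ≤-trans (s≤s (length≤∣p∣ xs-unique (xs∈p-x x≢xs xs∈p))) (x∈p⇒∣p-x∣<∣p∣ x∈p)
    where
    xs∈p-x : ∀ {x} {ys : List (Fin _)} → All (x ≢_) ys → All (_∈ p) ys → All (_∈ p - x) ys
    xs∈p-x []              []            = []
    xs∈p-x (x≢y ∷ x≢ys) (y∈p ∷ ys∈p) = x∈p∧x≢y⇒x∈p-y y∈p (≢-sym x≢y) ∷ xs∈p-x x≢ys ys∈p

  ∣p∣≤length⇒p⊆q : {xs : List (Fin n)} → Unique xs → All (_∈ p ∩ q) xs →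
                   ∣ p ∣ ≤ length xs → p ⊆ q
  ∣p∣≤length⇒p⊆q {p = p} {q} xs-unique xs∈p∩q ∣p∣≤length {x} x∈p with x ∈? q
  ... | yes x∈q = x∈q
  ... | no  x∉q = ⊥-elim (<⇒≱ ∣p∩q∣<∣p∣ (≤-trans ∣p∣≤length (length≤∣p∣ xs-unique xs∈p∩q)))
    where
    ∣p∩q∣<∣p∣ : ∣ p ∩ q ∣ < ∣ p ∣
    ∣p∩q∣<∣p∣ = p⊂q⇒∣p∣<∣q∣ (p∩q⊆p p q , x , x∈p , x∉q ∘ proj₂ ∘ x∈p∩q⁻ p q)

  module _ (M : Matroid n) where
    open Matroid M

    private variable
      C D A B T T₁ T₂ X : Subset n
      a : Fin n

    r∪≤r+r : ∀ X Y → r (X ∪ Y) ≤ r X + r Y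
    r∪≤r+r X Y = ≤-trans (m≤m+n _ _) (r-submod X Y)

    triangle⇒r≤2 : IsTriangle M T → r T ≤ 2
    triangle⇒r≤2 {T} ((r<∣T∣ , _) , ∣T∣≡3) = ≤-pred (subst (r T <_) ∣T∣≡3 r<∣T∣)

    circuit⇒r≤r[C-a] : IsCircuit M C → a ∈ C → r C ≤ r (C - a)
    circuit⇒r≤r[C-a] {C} {a} (r<∣C∣ , r[C-e]≡∣C-e∣) a∈C = begin
      r C             ≤⟨ ≤-pred (subst (r C <_) (x∈p⇒∣p∣≡1+∣p-x∣ a∈C) r<∣C∣) ⟩
      ∣ C - a ∣       ≡⟨ r[C-e]≡∣C-e∣ a a∈C ⟨
      r (C - a)       ∎
      where open ≤-Reasoning

    cocircuit⇒rM≤r[∁D∪X] : IsCocircuit M D → a ∈ D → a ∈ X → rM M ≤ r (∁ D ∪ X)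
    cocircuit⇒rM≤r[∁D∪X] {D} {a} (_ , r∁[D-e]≡rM) a∈D a∈X = begin
      rM M            ≡⟨ r∁[D-e]≡rM a a∈D ⟨
      r (∁ (D - a))   ≤⟨ r-mono _ _ (∁[p-x]⊆∁p∪q a∈X) ⟩
      r (∁ D ∪ _)     ∎
      where open ≤-Reasoning

    -- C - a lies in ∁ D and spans a, so ∁ D would span ∁ (D - a) and hence M.
    cocircuit∩circuit≢singleton : IsCocircuit M D → IsCircuit M C → a ∈ D → a ∈ C →
                                 (∀ x → x ∈ D → x ∈ C → x ≡ a) → ⊥
    cocircuit∩circuit≢singleton {D} {C} {a} d c a∈D a∈C D∩C⊆a =
      <⇒≱ (proj₁ d) (+-cancelʳ-≤ _ _ _ (begin
        rM M + r (C - a)            ≤⟨ +-mono-≤ (cocircuit⇒rM≤r[∁D∪X] d a∈D a∈C)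
                                                (r-mono _ _ C-a⊆∁D∩C) ⟩
        r (∁ D ∪ C) + r (∁ D ∩ C)   ≤⟨ r-submod (∁ D) C ⟩
        r (∁ D) + r C               ≤⟨ +-monoʳ-≤ (r (∁ D)) (circuit⇒r≤r[C-a] c a∈C) ⟩
        r (∁ D) + r (C - a)         ∎))
      where
      open ≤-Reasoning
      C-a⊆∁D∩C : C - a ⊆ ∁ D ∩ C
      C-a⊆∁D∩C {x} x∈C-a = x∈p∩q⁺ (x∉p⇒x∈∁p x∉D , p─q⊆p C ⁅ a ⁆ x∈C-a)
        where
        x∉D : x ∉ D
        x∉D x∈D = x∉p-x (subst (_∈ C - a) (D∩C⊆a x x∈D (p─q⊆p C ⁅ a ⁆ x∈C-a)) x∈C-a)

    cocircuit-meets-circuit-twice : IsCocircuit M D → IsCircuit M C → a ∈ D ∩ C →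
                                    ∃ λ b → b ∈ D ∩ C × b ≢ a
    cocircuit-meets-circuit-twice {D} {C} {a} d c a∈D∩C
      with any? (λ x → x ∈? D ∩ C ×-dec ¬? (x ≟ a))
    ... | yes witness = witness
    ... | no  none    = ⊥-elim (cocircuit∩circuit≢singleton d c a∈D a∈C λ x x∈D x∈C →
                          decidable-stable (x ≟ a) λ x≢a → none (x , x∈p∩q⁺ (x∈D , x∈C) , x≢a))
      where
      a∈D : a ∈ D
      a∈D = proj₁ (x∈p∩q⁻ D C a∈D∩C)
      a∈C : a ∈ C
      a∈C = proj₂ (x∈p∩q⁻ D C a∈D∩C)

    cocircuits⊆X⇒2+r∁X≤rM : IsCocircuit M A → IsCocircuit M B → A ⊆ X → B ⊆ X →
                            a ∈ A → a ∉ B → 2 + r (∁ X) ≤ rM M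
    cocircuits⊆X⇒2+r∁X≤rM {A} {B} {X} {a} A-cocircuit@(r∁A<rM , _) (r∁B<rM , _) A⊆X B⊆X a∈A a∉B =
      +-cancelˡ-≤ (rM M) _ _ (begin
        rM M + (2 + r (∁ X))          ≡⟨ trans (+-suc _ _) (cong suc (+-suc _ _)) ⟩
        2 + (rM M + r (∁ X))          ≤⟨ +-monoʳ-≤ 2 (begin
          rM M + r (∁ X)                ≤⟨ +-mono-≤ rM≤r[∁A∪∁B] (r-mono _ _ ∁X⊆∁A∩∁B) ⟩
          r (∁ A ∪ ∁ B) + r (∁ A ∩ ∁ B) ≤⟨ r-submod (∁ A) (∁ B) ⟩
          r (∁ A) + r (∁ B)             ∎) ⟩
        2 + (r (∁ A) + r (∁ B))       ≡⟨ cong suc (+-suc _ _) ⟨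
        suc (r (∁ A)) + suc (r (∁ B)) ≤⟨ +-mono-≤ r∁A<rM r∁B<rM ⟩
        rM M + rM M                   ∎)
      where
      open ≤-Reasoning
      rM≤r[∁A∪∁B] : rM M ≤ r (∁ A ∪ ∁ B)
      rM≤r[∁A∪∁B] = cocircuit⇒rM≤r[∁D∪X] A-cocircuit a∈A (x∉p⇒x∈∁p a∉B)
      ∁X⊆∁A∩∁B : ∁ X ⊆ ∁ A ∩ ∁ B
      ∁X⊆∁A∩∁B x∈∁X = x∈p∩q⁺ (p⊆q⇒∁p⊇∁q A⊆X x∈∁X , p⊆q⇒∁p⊇∁q B⊆X x∈∁X)

    cocircuits⊆X-equal : rM M ≤ suc (r (∁ X)) → IsCocircuit M A → IsCocircuit M B →
                         A ⊆ X → B ⊆ X → A ≡ B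
    cocircuits⊆X-equal {A = A} {B} rM≤1+r∁X a b A⊆X B⊆X with A ⊆? B | B ⊆? A
    ... | yes A⊆B | yes B⊆A = ⊆-antisym A⊆B B⊆A
    ... | no  A⊈B | _       = let (e , e∈A , e∉B) = p⊈q⇒∃∈p∉q A⊈B in
      ⊥-elim (<⇒≱ (cocircuits⊆X⇒2+r∁X≤rM a b A⊆X B⊆X e∈A e∉B) rM≤1+r∁X)
    ... | yes _   | no  B⊈A = let (e , e∈B , e∉A) = p⊈q⇒∃∈p∉q B⊈A in
      ⊥-elim (<⇒≱ (cocircuits⊆X⇒2+r∁X≤rM b a B⊆X A⊆X e∈B e∉A) rM≤1+r∁X)

    4-cocircuit⊆∪-of-disjoint-circuits : Is4Cocircuit M C → IsCircuit M A → IsCircuit M B →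
                                         A ∩ B ≡ ∅ → Meets C A → Meets C B → C ⊆ A ∪ B
    4-cocircuit⊆∪-of-disjoint-circuits {C} {A} {B} (c , ∣C∣≡4) α β A∩B≡∅ (a , a∈C∩A) (b , b∈C∩B)
      with cocircuit-meets-circuit-twice c α a∈C∩A | cocircuit-meets-circuit-twice c β b∈C∩B
    ... | a′ , a′∈C∩A , a′≢a | b′ , b′∈C∩B , b′≢b =
      ∣p∣≤length⇒p⊆q distinct in-C∩[A∪B] (≤-reflexive ∣C∣≡4)
      where
      apart : ∀ {x y} → x ∈ C ∩ A → y ∈ C ∩ B → x ≢ y
      apart x∈C∩A y∈C∩B refl =
        ∉⊥ (subst (_ ∈_) A∩B≡∅ (x∈p∩q⁺ (proj₂ (x∈p∩q⁻ C A x∈C∩A) , proj₂ (x∈p∩q⁻ C B y∈C∩B))))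
      distinct : Unique (a ∷ a′ ∷ b ∷ b′ ∷ [])
      distinct = (≢-sym a′≢a ∷ apart a∈C∩A b∈C∩B ∷ apart a∈C∩A b′∈C∩B ∷ [])
               ∷ (apart a′∈C∩A b∈C∩B ∷ apart a′∈C∩A b′∈C∩B ∷ [])
               ∷ (≢-sym b′≢b ∷ [])
               ∷ [] ∷ []
      C∩A⊆C∩[A∪B] : C ∩ A ⊆ C ∩ (A ∪ B)
      C∩A⊆C∩[A∪B] x∈C∩A with x∈p∩q⁻ C A x∈C∩A
      ... | x∈C , x∈A = x∈p∩q⁺ (x∈C , p⊆p∪q B x∈A)
      C∩B⊆C∩[A∪B] : C ∩ B ⊆ C ∩ (A ∪ B)
      C∩B⊆C∩[A∪B] x∈C∩B with x∈p∩q⁻ C B x∈C∩B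
      ... | x∈C , x∈B = x∈p∩q⁺ (x∈C , q⊆p∪q A B x∈B)
      in-C∩[A∪B] : All (_∈ C ∩ (A ∪ B)) (a ∷ a′ ∷ b ∷ b′ ∷ [])
      in-C∩[A∪B] = C∩A⊆C∩[A∪B] a∈C∩A ∷ C∩A⊆C∩[A∪B] a′∈C∩A
                 ∷ C∩B⊆C∩[A∪B] b∈C∩B ∷ C∩B⊆C∩[A∪B] b′∈C∩B ∷ []

    no-3-separation-with-large-sides : InternallyFourConnected M → 4 ≤ ∣ X ∣ → 4 ≤ ∣ ∁ X ∣ →
                                       ¬ (r X + r (∁ X) < rM M + 3)
    no-3-separation-with-large-sides {X} (_ , small-side) 4≤∣X∣ 4≤∣∁X∣ λX<3
      with small-side X (<⇒≤ 4≤∣X∣ , <⇒≤ 4≤∣∁X∣ , λX<3)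
    ... | inj₁ (inj₁ (_ , ∣X∣≡3))  = <-irrefl (sym ∣X∣≡3) 4≤∣X∣
    ... | inj₁ (inj₂ (_ , ∣X∣≡3))  = <-irrefl (sym ∣X∣≡3) 4≤∣X∣
    ... | inj₂ (inj₁ (_ , ∣∁X∣≡3)) = <-irrefl (sym ∣∁X∣≡3) 4≤∣∁X∣
    ... | inj₂ (inj₂ (_ , ∣∁X∣≡3)) = <-irrefl (sym ∣∁X∣≡3) 4≤∣∁X∣

    rM≤1+r∁[T₁∪T₂] : InternallyFourConnected M → 10 ≤ n → IsTriangle M T₁ → IsTriangle M T₂ →
                     T₁ ∩ T₂ ≡ ∅ → rM M ≤ suc (r (∁ (T₁ ∪ T₂)))
    rM≤1+r∁[T₁∪T₂] {T₁} {T₂} i4c 10≤n t₁ t₂ T₁∩T₂≡∅ = ≤-pred (≰⇒> λ 2+r∁[T₁∪T₂]≤rM →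
      no-3-separation-with-large-sides i4c 4≤∣T₁∪T₂∣ 4≤∣∁[T₁∪T₂]∣ (begin-strict
        r (T₁ ∪ T₂) + r (∁ (T₁ ∪ T₂))  ≤⟨ +-monoˡ-≤ _ r[T₁∪T₂]≤4 ⟩
        4 + r (∁ (T₁ ∪ T₂))            <⟨ +-monoʳ-≤ 3 2+r∁[T₁∪T₂]≤rM ⟩
        3 + rM M                       ≡⟨ +-comm 3 (rM M) ⟩
        rM M + 3                       ∎))
      where
      open ≤-Reasoning
      ∣T₁∪T₂∣≡6 : ∣ T₁ ∪ T₂ ∣ ≡ 6
      ∣T₁∪T₂∣≡6 = trans (∣p∪q∣≡∣p∣+∣q∣ T₁ T₂ T₁∩T₂≡∅) (cong₂ _+_ (proj₂ t₁) (proj₂ t₂))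
      4≤∣T₁∪T₂∣ : 4 ≤ ∣ T₁ ∪ T₂ ∣
      4≤∣T₁∪T₂∣ = subst (4 ≤_) (sym ∣T₁∪T₂∣≡6) (m≤m+n 4 2)
      4≤∣∁[T₁∪T₂]∣ : 4 ≤ ∣ ∁ (T₁ ∪ T₂) ∣
      4≤∣∁[T₁∪T₂]∣ = subst (4 ≤_) (sym (trans (∣∁p∣≡n∸∣p∣ (T₁ ∪ T₂)) (cong (n ∸_) ∣T₁∪T₂∣≡6)))
                           (∸-monoˡ-≤ 6 10≤n)
      r[T₁∪T₂]≤4 : r (T₁ ∪ T₂) ≤ 4
      r[T₁∪T₂]≤4 = ≤-trans (r∪≤r+r T₁ T₂) (+-mono-≤ (triangle⇒r≤2 t₁) (triangle⇒r≤2 t₂))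

    bowtie-4-cocircuit-unique : 10 ≤ n → InternallyFourConnected M → IsBowtie M T₁ T₂ D →
                                Is4Cocircuit M C → Meets C T₁ → Meets C T₂ → C ≡ D
    bowtie-4-cocircuit-unique {T₁} {T₂} {D} {C} 10≤n i4c (t₁ , t₂ , T₁∩T₂≡∅ , (d , _) , D⊆T₁∪T₂)
                              C-4cocircuit@(c , _) C∩T₁ C∩T₂ =
      cocircuits⊆X-equal (rM≤1+r∁[T₁∪T₂] i4c 10≤n t₁ t₂ T₁∩T₂≡∅) c d C⊆T₁∪T₂ D⊆T₁∪T₂
      where
      C⊆T₁∪T₂ : C ⊆ T₁ ∪ T₂
      C⊆T₁∪T₂ = 4-cocircuit⊆∪-of-disjoint-circuits C-4cocircuit (proj₁ t₁) (proj₁ t₂) T₁∩T₂≡∅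
                                                   C∩T₁ C∩T₂

lemma4p2 : ∀ {n : ℕ} (M : Matroid n) → 10 ≤ n → InternallyFourConnected M →
           (e₁ e₂ e₃ e₄ e₅ e₆ : Fin n) →
           IsBowtie M ⁅ e₁ , e₂ , e₃ ⁆ ⁅ e₄ , e₅ , e₆ ⁆ ⁅ e₂ , e₃ , e₄ , e₅ ⁆ →
           (C : Subset n) → Is4Cocircuit M C →
           Meets C ⁅ e₁ , e₂ , e₃ ⁆ → Meets C ⁅ e₄ , e₅ , e₆ ⁆ →
           C ≡ ⁅ e₂ , e₃ , e₄ , e₅ ⁆
lemma4p2 M 10≤n i4c _ _ _ _ _ _ bowtie _ = bowtie-4-cocircuit-unique M 10≤n i4c bowtie
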